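{- Let $n\ge1$ and $G=(\mathbb{Z}/n\mathbb{Z}\times\mathbb{Z}/n\mathbb{Z})\rtimes_\varphi\mathbb{Z}/2\mathbb{Z}$, where, with $\tau$ the generator of $\mathbb{Z}/2\mathbb{Z}$ and $\alpha,\beta$ generators of the first and second factors $\mathbb{Z}/n\mathbb{Z}$, $\varphi(\tau)$ is the automorphism swapping $\alpha\mapsto\beta$, $\beta\mapsto\alpha$. Then for every subgroup $H\le G$ containing the element $(0,\tau)$ (whose $\mathbb{Z}/n\mathbb{Z}\times\mathbb{Z}/n\mathbb{Z}$-component is the identity), the set $\{\#K: H\le K\le G\}$ equals the set of positive integers $m$ with $\#H\mid m\mid \#G$. -}

module Defs where

open import Data.Nat using (ℕ; zero; suc; _+_; _∸_; NonZero)
open import Data.Nat.DivMod using (_mod_)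
open import Data.Fin using (Fin; toℕ) renaming (zero to fz; suc to fs)
open import Data.Bool using (Bool; true; false)
open import Data.Product using (_×_; _,_)
open import Data.List using (List; length; filter; allFin; concatMap; map)
open import Relation.Binary.PropositionalEquality using (_≡_)
open import Relation.Nullary.Decidable using (Dec)
open import Data.Bool.Properties using (T?)
open import Data.Bool using (T)

module _ (n : ℕ) .{{_ : NonZero n}} where

  addZ : Fin n → Fin n → Fin n
  addZ a b = (toℕ a + toℕ b) mod n

  negZ : Fin n → Fin n
  negZ a = (n ∸ toℕ a) mod n

  zeroZ : Fin n
  zeroZ = 0 mod n

-- Elements of G = (ℤ/n × ℤ/n) ⋊ ℤ/2 : triples (a , b , t), with
-- t = false meaning the identity of ℤ/2 and t = true meaning τ.
G : ℕ → Set
G n = Fin n × Fin n × Bool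

module _ {n : ℕ} .{{_ : NonZero n}} where

  act : Bool → Fin n × Fin n → Fin n × Fin n
  act false (a , b) = (a , b)
  act true  (a , b) = (b , a)

  xor : Bool → Bool → Bool
  xor false t = t
  xor true  t = not' t
    where
    not' : Bool → Bool
    not' false = true
    not' true  = false

  _·_ : G n → G n → G n
  (a , b , t) · (a' , b' , t') with act t (a' , b')
  ... | (c , d) = (addZ n a c , addZ n b d , xor t t')

  e : G n
  e = (zeroZ n , zeroZ n , false)

  inv : G n → G n
  inv (a , b , t) with act t (negZ n a , negZ n b)
  ... | (c , d) = (c , d , t)

  τ : G n
  τ = (zeroZ n , zeroZ n , true)

elements : (n : ℕ) → List (G n)
elements n = concatMap (λ a → concatMap (λ b → map (λ t → (a , b , t)) (false Data.List.∷ true Data.List.∷ Data.List.[])) (allFin n)) (allFin n)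

Subset : ℕ → Set
Subset n = G n → Bool

_∈_ : {n : ℕ} → G n → Subset n → Set
g ∈ S = S g ≡ true

card : {n : ℕ} → Subset n → ℕ
card {n} S = length (filter (λ g → T? (S g)) (elements n))

orderG : (n : ℕ) → ℕ
orderG n = card {n} (λ _ → true)

_⊆_ : {n : ℕ} → Subset n → Subset n → Set
_⊆_ {n} S T' = (g : G n) → g ∈ S → g ∈ T'

record IsSubgroup {n : ℕ} .{{_ : NonZero n}} (H : Subset n) : Set where
  field
    has-e   : e ∈ H
    closed· : (g h : G n) → g ∈ H → h ∈ H → (g · h) ∈ H
    closed⁻ : (g : G n) → g ∈ H → inv g ∈ H

module Submission where

-- A subgroup K ∋ τ is L ⋊ ⟨τ⟩ for its translation part L ≤ A = ℤ/n × ℤ/n,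
-- which is invariant under the swap σ = φ(τ), and |K| = 2|L|; conversely every
-- σ-invariant subgroup L of A gives such a K.  Necessity is then Lagrange's
-- theorem in A.  For sufficiency we show: if L is σ-invariant and q·|L| divides
-- |A|, some σ-invariant L′ ⊇ L has |L′| = q·|L|.  Factor q into primes; for one
-- prime p, Cauchy's theorem for A/L gives z of order p modulo L, and z or z + σz
-- is an element x of order p with σx ≡ ±x modulo L, so L + ⟨x⟩ works.

open import Defs
open import Algebra.Bundles using (AbelianGroup)
open import Algebra.Core using (Op₁; Op₂)
open import Algebra.Structures using (IsAbelianGroup)
open import Data.Bool using (Bool; true; false; _∨_; _∧_; not)
open import Data.Bool.Properties using (T?)
open import Data.Empty using (⊥-elim)
open import Data.Fin using (Fin; toℕ)
open import Data.Fin.Permutation using (Permutation; permutation)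
open import Data.Fin.Properties using (toℕ-injective; toℕ-fromℕ<; toℕ<n)
open import Data.List using (List; []; _∷_; _++_; length; map; filter; concatMap; allFin; tabulate)
open import Data.List.Properties using (map-++; map-tabulate; map-cong)
open import Data.List.Relation.Unary.All using (All; []; _∷_)
open import Data.Nat using (ℕ; >-nonZero; >-nonZero⁻¹; zero; suc; _+_; _*_; _∸_; _%_; _/_; _≤_; _<_; z≤n; s≤s; NonZero)
open import Data.Nat.DivMod using (_mod_; m≡m%n+[m/n]*n; m%n<n; %-distribˡ-+; m%n%n≡m%n; m<n⇒m%n≡m; n%n≡0; m*n%n≡0; %-distribˡ-*)
open import Data.Nat.Divisibility using (_∣_; divides; _∣0; ∣-refl; ∣-trans; ∣m∣n⇒∣m+n; ∣⇒≤; m%n≡0⇒n∣m; *-monoʳ-∣; *-cancelˡ-∣; *-cancelʳ-∣)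
open import Data.Nat.Induction using (<-rec)
open import Data.Nat.ListAction using (product) renaming (sum to listSum)
open import Data.Nat.ListAction.Properties using () renaming (sum-++ to listSum-++)
open import Data.Nat.Primality using (Prime; prime⇒nonZero; prime⇒irreducible; euclidsLemma)
open import Data.Nat.Primality.Factorisation using (factorise; PrimeFactorisation)
open import Data.Nat.Properties
open import Algebra.Properties.CommutativeMonoid.Sum +-0-commutativeMonoid using (sum; sum-permute; sum-cong-≗; ∑-distrib-+)
open import Data.Product using (Σ; ∃; ∃₂; _×_; _,_; proj₁; proj₂)
open import Data.Sum using (_⊎_; inj₁; inj₂)
open import Level using (0ℓ)
open import Relation.Nullary using (yes; no)
open import Relation.Binary.PropositionalEquality

q*[p*s]≡[p*q]*s : ∀ p q s → q * (p * s) ≡ (p * q) * s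
q*[p*s]≡[p*q]*s p q s = trans (sym (*-assoc q p s)) (cong (_* s) (*-comm q p))

_∈ᴮ_ : {X : Set} → X → (X → Bool) → Set
x ∈ᴮ S = S x ≡ true

ind : Bool → ℕ
ind true  = 1
ind false = 0

ind-remove : ∀ b c → (c ≡ true → b ≡ true) → ind b ≡ ind (b ∧ not c) + ind c
ind-remove true  true  _ = refl
ind-remove true  false _ = refl
ind-remove false false _ = refl
ind-remove false true  c⇒b with () ← c⇒b refl

ind-positive : ∀ {b} → 0 < ind b → b ≡ true
ind-positive {true} _ = refl

∧-not-intro : ∀ {b c} → b ≡ true → c ≡ false → b ∧ not c ≡ true
∧-not-intro refl refl = refl

∧-not-elim : ∀ b c → b ∧ not c ≡ true → b ≡ true × c ≡ false
∧-not-elim true false _ = refl , refl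

contraposeᴮ : ∀ {b c} → (b ≡ true → c ≡ true) → c ≡ false → b ≡ false
contraposeᴮ {false} _ _ = refl
contraposeᴮ {true} b⇒c c≡false = trans (sym (b⇒c refl)) c≡false

Bool-ext : ∀ {b c : Bool} → (b ≡ true → c ≡ true) → (c ≡ true → b ≡ true) → b ≡ c
Bool-ext {true}          b⇒c _   = sym (b⇒c refl)
Bool-ext {false} {true}  _   c⇒b = c⇒b refl
Bool-ext {false} {false} _   _   = refl

minimise : (P : ℕ → Bool) → ∀ N → P N ≡ true →
           ∃ λ d → P d ≡ true × (∀ {j} → j < d → P j ≡ false)
minimise P zero    PN = 0 , PN , λ ()
minimise P (suc N) PN with P 0 in P0
... | true  = 0 , P0 , λ ()
... | false with minimise (λ j → P (suc j)) N PN
...   | d , Pd , below = suc d , Pd , λ { {zero} _ → P0 ; {suc j} (s≤s j<d) → below j<d }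

anyBelow : ℕ → (ℕ → Bool) → Bool
anyBelow zero    P = false
anyBelow (suc d) P = P d ∨ anyBelow d P

anyBelow-intro : ∀ {d} P {j} → j < d → P j ≡ true → anyBelow d P ≡ true
anyBelow-intro {suc d} P {j} j<1+d Pj with P d in Pd | m<1+n⇒m<n∨m≡n j<1+d
... | true  | _           = refl
... | false | inj₁ j<d    = anyBelow-intro P j<d Pj
... | false | inj₂ refl   with () ← trans (sym Pd) Pj

anyBelow-elim : ∀ d P → anyBelow d P ≡ true → ∃ λ j → j < d × P j ≡ true
anyBelow-elim (suc d) P any with P d in Pd
... | true  = d , ≤-refl , Pd
... | false with anyBelow-elim d P any
...   | j , j<d , Pj = j , m<n⇒m<1+n j<d , Pj

sumBelow : ℕ → (ℕ → ℕ) → ℕ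
sumBelow zero    g = 0
sumBelow (suc d) g = g d + sumBelow d g

sumBelow-cong : ∀ d {g h} → (∀ j → g j ≡ h j) → sumBelow d g ≡ sumBelow d h
sumBelow-cong zero    _   = refl
sumBelow-cong (suc d) g≗h = cong₂ _+_ (g≗h d) (sumBelow-cong d g≗h)

sumBelow-const : ∀ d c → sumBelow d (λ _ → c) ≡ d * c
sumBelow-const zero    c = refl
sumBelow-const (suc d) c = cong (c +_) (sumBelow-const d c)

sumBelow-zero : ∀ d g → (∀ {j} → j < d → g j ≡ 0) → sumBelow d g ≡ 0
sumBelow-zero zero    g _    = refl
sumBelow-zero (suc d) g vanish = cong₂ _+_ (vanish ≤-refl) (sumBelow-zero d g (λ j<d → vanish (m<n⇒m<1+n j<d)))

ind-anyBelow : ∀ d P → (∀ {i j} → i < d → j < d → P i ≡ true → P j ≡ true → i ≡ j) →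
               ind (anyBelow d P) ≡ sumBelow d (λ j → ind (P j))
ind-anyBelow zero    P unique = refl
ind-anyBelow (suc d) P unique with P d in Pd
... | true  = cong suc (sym (sumBelow-zero d _ others-false))
  where
  others-false : ∀ {j} → j < d → ind (P j) ≡ 0
  others-false {j} j<d with P j in Pj
  ... | false = refl
  ... | true  = ⊥-elim (<-irrefl (unique (m<n⇒m<1+n j<d) ≤-refl Pj Pd) j<d)
... | false = ind-anyBelow d P (λ i<d j<d → unique (m<n⇒m<1+n i<d) (m<n⇒m<1+n j<d))

-- A translation-invariant counting functional on a finite group: summation
-- over all elements.  It is all that the counting arguments below need.
record Counting (A : Set) (_⊕_ : Op₂ A) : Set where
  field
    ∑         : (A → ℕ) → ℕ
    ∑-cong    : ∀ {f g} → (∀ v → f v ≡ g v) → ∑ f ≡ ∑ g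
    ∑-+       : ∀ f g → ∑ (λ v → f v + g v) ≡ ∑ f + ∑ g
    ∑-shift   : ∀ f c → ∑ (λ v → f (v ⊕ c)) ≡ ∑ f
    ∑-point   : ∀ f v → f v ≤ ∑ f
    ∑-support : ∀ f → 0 < ∑ f → ∃ λ v → 0 < f v

record FiniteAbelianGroup : Set₁ where
  infixl 6 _⊕_
  field
    Carrier        : Set
    _⊕_            : Op₂ Carrier
    𝟘              : Carrier
    ⊖_             : Op₁ Carrier
    isAbelianGroup : IsAbelianGroup _≡_ _⊕_ 𝟘 ⊖_
    counting       : Counting Carrier _⊕_

module FiniteAbelianGroupTheory (𝔸 : FiniteAbelianGroup) where

  open FiniteAbelianGroup 𝔸 renaming (Carrier to A)
  open IsAbelianGroup isAbelianGroup using (assoc; comm; inverseʳ; identityʳ; _-_)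
  open Counting counting

  abelianGroup : AbelianGroup 0ℓ 0ℓ
  abelianGroup = record { isAbelianGroup = isAbelianGroup }

  open AbelianGroup abelianGroup using (commutativeMonoid)
  import Algebra.Properties.AbelianGroup
  open Algebra.Properties.AbelianGroup abelianGroup
    using ( inverseʳ-unique; ⁻¹-anti-homo‿-; ⁻¹-∙-comm; ⁻¹-involutive; ε⁻¹≈ε
          ; //-rightDividesˡ; //-rightDividesʳ)
  open import Algebra.Properties.CommutativeSemigroup (AbelianGroup.commutativeSemigroup abelianGroup)
    using (interchange; x∙yz≈y∙xz)
  open import Algebra.Definitions.RawMonoid (AbelianGroup.rawMonoid abelianGroup) public
    using () renaming (_×_ to _⊗_)
  open import Algebra.Properties.CommutativeMonoid.Mult commutativeMonoid
    using (×-homo-1; ×-homo-+; ×-assocˡ; ×-distrib-+)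
  open import Algebra.Properties.Loop (Algebra.Properties.AbelianGroup.loop abelianGroup) using (identityʳ-unique)

  size : (A → Bool) → ℕ
  size S = ∑ (λ v → ind (S v))

  -- Summation is additive, hence kills the zero function.
  ∑-zero : ∑ (λ _ → 0) ≡ 0
  ∑-zero = +-cancelˡ-≡ s _ _ (trans (sym (∑-+ (λ _ → 0) (λ _ → 0))) (sym (+-identityʳ s)))
    where s = ∑ (λ _ → 0)

  ∑-sumBelow : ∀ d (g : ℕ → A → ℕ) → ∑ (λ v → sumBelow d (λ j → g j v)) ≡ sumBelow d (λ j → ∑ (g j))
  ∑-sumBelow zero    g = ∑-zero
  ∑-sumBelow (suc d) g = trans (∑-+ (g d) _) (cong (∑ (g d) +_) (∑-sumBelow d g))

  size-≥1 : ∀ {S} {v} → v ∈ᴮ S → 1 ≤ size S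
  size-≥1 {S} {v} v∈S = subst (λ b → ind b ≤ size S) v∈S (∑-point (λ w → ind (S w)) v)

  record IsSubgroupᴮ (M : A → Bool) : Set where
    field
      𝟘∈ : 𝟘 ∈ᴮ M
      ⊕∈ : ∀ {x y} → x ∈ᴮ M → y ∈ᴮ M → (x ⊕ y) ∈ᴮ M
      ⊖∈ : ∀ {x} → x ∈ᴮ M → (⊖ x) ∈ᴮ M

    ⊗∈ : ∀ j {x} → x ∈ᴮ M → (j ⊗ x) ∈ᴮ M
    ⊗∈ zero    x∈M = 𝟘∈
    ⊗∈ (suc j) x∈M = ⊕∈ x∈M (⊗∈ j x∈M)

  sub-interchange : ∀ a b c d → (a - b) ⊕ (c - d) ≡ (a ⊕ c) - (b ⊕ d)
  sub-interchange a b c d = trans (interchange a (⊖ b) c (⊖ d)) (cong ((a ⊕ c) ⊕_) (⁻¹-∙-comm b d))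

  sub-telescope : ∀ x y z → (x - y) ⊕ (y - z) ≡ x - z
  sub-telescope x y z = begin
    (x - y) ⊕ (y - z)   ≡⟨ sym (assoc (x - y) y (⊖ z)) ⟩
    ((x - y) ⊕ y) - z   ≡⟨ cong (_- z) (//-rightDividesˡ y x) ⟩
    x - z               ∎
    where open ≡-Reasoning

  add-sub : ∀ v w → w ⊕ (v - w) ≡ v
  add-sub v w = trans (x∙yz≈y∙xz w v (⊖ w)) (trans (cong (v ⊕_) (inverseʳ w)) (identityʳ v))

  sub-𝟘 : ∀ x → x - 𝟘 ≡ x
  sub-𝟘 x = trans (cong (x ⊕_) ε⁻¹≈ε) (identityʳ x)

  -- Congruence modulo a subgroup M: x ∼ y iff x - y ∈ M.  This is the
  -- quotient A/M in disguise.
  module Modulo {M : A → Bool} (M-sub : IsSubgroupᴮ M) where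
    open IsSubgroupᴮ M-sub

    infix 4 _∼_
    _∼_ : A → A → Set
    x ∼ y = (x - y) ∈ᴮ M

    ∼-refl : ∀ {x} → x ∼ x
    ∼-refl {x} = subst (_∈ᴮ M) (sym (inverseʳ x)) 𝟘∈

    ∼-sym : ∀ {x y} → x ∼ y → y ∼ x
    ∼-sym {x} {y} x∼y = subst (_∈ᴮ M) (⁻¹-anti-homo‿- x y) (⊖∈ x∼y)

    ∼-trans : ∀ {x y z} → x ∼ y → y ∼ z → x ∼ z
    ∼-trans {x} {y} {z} x∼y y∼z = subst (_∈ᴮ M) (sub-telescope x y z) (⊕∈ x∼y y∼z)

    ∼-⊕ : ∀ {a b c d} → a ∼ b → c ∼ d → a ⊕ c ∼ b ⊕ d
    ∼-⊕ {a} {b} {c} {d} a∼b c∼d = subst (_∈ᴮ M) (sub-interchange a b c d) (⊕∈ a∼b c∼d)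

    ∼-⊖ : ∀ {a b} → a ∼ b → ⊖ a ∼ ⊖ b
    ∼-⊖ {a} {b} a∼b = subst (_∈ᴮ M) (sym (⁻¹-∙-comm a (⊖ b))) (⊖∈ a∼b)

    ∈⇒∼𝟘 : ∀ {x} → x ∈ᴮ M → x ∼ 𝟘
    ∈⇒∼𝟘 {x} = subst (_∈ᴮ M) (sym (sub-𝟘 x))

    ∼𝟘⇒∈ : ∀ {x} → x ∼ 𝟘 → x ∈ᴮ M
    ∼𝟘⇒∈ {x} = subst (_∈ᴮ M) (sub-𝟘 x)

    ⊕-∼ : ∀ {v m} → m ∈ᴮ M → v ⊕ m ∼ v
    ⊕-∼ {v} {m} m∈M = subst (λ u → (u - v) ∈ᴮ M) (comm m v) (subst (_∈ᴮ M) (sym (//-rightDividesʳ v m)) m∈M)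

    ⊕∈⇒∼⊖ : ∀ {a b} → (a ⊕ b) ∈ᴮ M → a ∼ ⊖ b
    ⊕∈⇒∼⊖ {a} {b} = subst (λ u → (a ⊕ u) ∈ᴮ M) (sym (⁻¹-involutive b))

    Saturated : (A → Bool) → Set
    Saturated S = ∀ {v m} → v ∈ᴮ S → m ∈ᴮ M → (v ⊕ m) ∈ᴮ S

    saturated-∼ : ∀ {S} → Saturated S → ∀ {v w} → v ∼ w → w ∈ᴮ S → v ∈ᴮ S
    saturated-∼ {S} S-sat {v} {w} v∼w w∈S = subst (_∈ᴮ S) (add-sub v w) (S-sat w∈S v∼w)

    size-coset : ∀ s → size (λ v → M (v - s)) ≡ size M
    size-coset s = ∑-shift (λ v → ind (M v)) (⊖ s)

    -- Lagrange's theorem, in the form: |M| divides the size of every union of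
    -- cosets of M.  Induction on the size, removing one coset at a time.
    lagrange : ∀ {S} → Saturated S → size M ∣ size S
    lagrange {S} S-sat = <-rec P step (size S) refl S-sat
      where
      P : ℕ → Set
      P k = ∀ {S} → size S ≡ k → Saturated S → size M ∣ k
      step : ∀ k → (∀ {j} → j < k → P j) → P k
      step zero    _  _          _     = _ ∣0
      step (suc k) ih {S} size≡ S-sat =
        subst (size M ∣_) (trans (sym size-split) size≡)
              (∣m∣n⇒∣m+n (ih S′<S refl S′-sat) ∣-refl)
        where
        some-s : ∃ λ s → 0 < ind (S s)
        some-s = ∑-support _ (subst (0 <_) (sym size≡) (s≤s z≤n))
        s : A
        s = proj₁ some-s
        s∈S : s ∈ᴮ S
        s∈S = ind-positive (proj₂ some-s)
        C : A → Bool
        C v = M (v - s)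
        S′ : A → Bool
        S′ v = S v ∧ not (C v)
        C⊆S : ∀ {v} → v ∈ᴮ C → v ∈ᴮ S
        C⊆S v∼s = saturated-∼ S-sat v∼s s∈S
        size-split : size S ≡ size S′ + size M
        size-split = trans (∑-cong (λ v → ind-remove (S v) (C v) C⊆S))
                           (trans (∑-+ _ _) (cong (size S′ +_) (size-coset s)))
        S′<S : size S′ < suc k
        S′<S = subst (size S′ <_) (trans (sym size-split) size≡)
                 (≤-trans (≤-reflexive (+-comm 1 (size S′))) (+-monoʳ-≤ (size S′) (size-≥1 {M} 𝟘∈)))
        S′-sat : Saturated S′
        S′-sat {v} {m} v∈S′ m∈M with ∧-not-elim (S v) (C v) v∈S′
        ... | v∈S , v∉C = ∧-not-intro (S-sat v∈S m∈M)
                              (contraposeᴮ (λ v+m∼s → ∼-trans (∼-sym (⊕-∼ m∈M)) v+m∼s) v∉C)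

    -- d is the order of x modulo M, i.e. the order of the class of x in A/M.
    record OrderModulo (x : A) (d : ℕ) : Set where
      field
        positive : 0 < d
        kills    : (d ⊗ x) ∈ᴮ M
        minimal  : ∀ {j} → (j ⊗ x) ∈ᴮ M → d ∣ j

    ⊗-mod : ∀ {x d} .{{_ : NonZero d}} → (d ⊗ x) ∈ᴮ M → ∀ t → t ⊗ x ∼ (t % d) ⊗ x
    ⊗-mod {x} {d} dx∈M t = subst (_∼ (t % d) ⊗ x) (sym t⊗x≡) (⊕-∼ (⊗∈ (t / d) dx∈M))
      where
      t⊗x≡ : t ⊗ x ≡ (t % d) ⊗ x ⊕ (t / d) ⊗ (d ⊗ x)
      t⊗x≡ = begin
        t ⊗ x                               ≡⟨ cong (_⊗ x) (m≡m%n+[m/n]*n t d) ⟩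
        (t % d + (t / d) * d) ⊗ x           ≡⟨ ×-homo-+ x (t % d) ((t / d) * d) ⟩
        (t % d) ⊗ x ⊕ ((t / d) * d) ⊗ x     ≡⟨ cong ((t % d) ⊗ x ⊕_) (sym (×-assocˡ x (t / d) d)) ⟩
        (t % d) ⊗ x ⊕ (t / d) ⊗ (d ⊗ x)     ∎
        where open ≡-Reasoning

    -- If some positive multiple of x lies in M, then x has an order modulo M:
    -- the least such multiple.
    order-exists : ∀ {x} N .{{_ : NonZero N}} → (N ⊗ x) ∈ᴮ M → ∃ (OrderModulo x)
    order-exists {x} (suc N) Nx∈M with minimise (λ j → M (suc j ⊗ x)) N Nx∈M
    ... | d , dx∈M , below = suc d , record { positive = s≤s z≤n ; kills = dx∈M ; minimal = minimal }
      where
      minimal : ∀ {j} → (j ⊗ x) ∈ᴮ M → suc d ∣ j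
      minimal {j} jx∈M = remainder-zero (j % suc d) refl (m%n<n j (suc d))
        where
        reduced : ((j % suc d) ⊗ x) ∈ᴮ M
        reduced = ∼𝟘⇒∈ (∼-trans (∼-sym (⊗-mod dx∈M j)) (∈⇒∼𝟘 jx∈M))
        remainder-zero : ∀ r → j % suc d ≡ r → r < suc d → suc d ∣ j
        remainder-zero zero    r≡ _         = m%n≡0⇒n∣m j (suc d) r≡
        remainder-zero (suc r) r≡ (s≤s r<d)
          with () ← trans (sym (subst (λ u → (u ⊗ x) ∈ᴮ M) r≡ reduced)) (below r<d)

    -- Adjoining to M an element x of order d modulo M: the subgroup M + ⟨x⟩,
    -- which consists of d cosets of M.
    module Span {x d} (x-ord : OrderModulo x d) where
      open OrderModulo x-ord

      private instance
        d-nonZero : NonZero d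
        d-nonZero = >-nonZero positive

      span : A → Bool
      span v = anyBelow d (λ j → M (v - j ⊗ x))

      span-intro : ∀ {v} t → v ∼ t ⊗ x → v ∈ᴮ span
      span-intro {v} t v∼tx = anyBelow-intro (λ j → M (v - j ⊗ x)) (m%n<n t d) (∼-trans v∼tx (⊗-mod kills t))

      span-elim : ∀ {v} → v ∈ᴮ span → ∃ λ j → j < d × v ∼ j ⊗ x
      span-elim {v} = anyBelow-elim d (λ j → M (v - j ⊗ x))

      span-saturated : ∀ {v w} → v ∼ w → w ∈ᴮ span → v ∈ᴮ span
      span-saturated v∼w w∈span with span-elim w∈span
      ... | j , _ , w∼jx = span-intro j (∼-trans v∼w w∼jx)

      M⊆span : ∀ {v} → v ∈ᴮ M → v ∈ᴮ span
      M⊆span v∈M = span-intro 0 (∈⇒∼𝟘 v∈M)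

      x∈span : x ∈ᴮ span
      x∈span = span-intro 1 (subst (x ∼_) (sym (identityʳ x)) ∼-refl)

      span-subgroup : IsSubgroupᴮ span
      span-subgroup = record { 𝟘∈ = M⊆span 𝟘∈ ; ⊕∈ = closed-⊕ ; ⊖∈ = closed-⊖ }
        where
        closed-⊕ : ∀ {v w} → v ∈ᴮ span → w ∈ᴮ span → (v ⊕ w) ∈ᴮ span
        closed-⊕ v∈span w∈span with span-elim v∈span | span-elim w∈span
        ... | j , _ , v∼jx | k , _ , w∼kx =
          span-intro (j + k) (subst (_ ∼_) (sym (×-homo-+ x j k)) (∼-⊕ v∼jx w∼kx))
        closed-⊖ : ∀ {v} → v ∈ᴮ span → (⊖ v) ∈ᴮ span
        closed-⊖ v∈span with span-elim v∈span
        ... | j , j<d , v∼jx = span-intro (d ∸ j) (∼-trans (∼-⊖ v∼jx) (∼-sym (⊕∈⇒∼⊖ complement)))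
          where
          complement : ((d ∸ j) ⊗ x ⊕ j ⊗ x) ∈ᴮ M
          complement = subst (_∈ᴮ M) (trans (cong (_⊗ x) (sym (m∸n+n≡m (<⇒≤ j<d)))) (×-homo-+ x (d ∸ j) j)) kills

      ∼-multiples-≤ : ∀ {i j} → j < d → i ⊗ x ∼ j ⊗ x → j ≤ i
      ∼-multiples-≤ {i} {j} j<d ix∼jx with i <? j
      ... | no  i≮j = ≮⇒≥ i≮j
      ... | yes i<j = ⊥-elim (<-irrefl refl (≤-<-trans (∣⇒≤ {{>-nonZero (m<n⇒0<n∸m i<j)}} d∣j∸i)
                                                        (≤-<-trans (m∸n≤m j i) j<d)))
        where
        difference : j ⊗ x - i ⊗ x ≡ (j ∸ i) ⊗ x
        difference = trans (cong (λ u → u ⊗ x - i ⊗ x) (sym (m∸n+n≡m (<⇒≤ i<j))))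
                           (trans (cong (_- i ⊗ x) (×-homo-+ x (j ∸ i) i)) (//-rightDividesʳ (i ⊗ x) _))
        d∣j∸i : d ∣ j ∸ i
        d∣j∸i = minimal (∼𝟘⇒∈ (subst₂ _∼_ difference (inverseʳ (i ⊗ x))
                                (∼-⊕ (∼-sym ix∼jx) (∼-refl {⊖ (i ⊗ x)}))))

      ∼-multiples-unique : ∀ {v i j} → i < d → j < d → v ∼ i ⊗ x → v ∼ j ⊗ x → i ≡ j
      ∼-multiples-unique i<d j<d v∼ix v∼jx =
        ≤-antisym (∼-multiples-≤ i<d (∼-trans (∼-sym v∼jx) v∼ix))
                  (∼-multiples-≤ j<d (∼-trans (∼-sym v∼ix) v∼jx))

      size-span : size span ≡ d * size M
      size-span = begin
        size span
          ≡⟨ ∑-cong (λ v → ind-anyBelow d _ (∼-multiples-unique {v})) ⟩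
        ∑ (λ v → sumBelow d (λ j → ind (M (v - j ⊗ x))))
          ≡⟨ ∑-sumBelow d (λ j v → ind (M (v - j ⊗ x))) ⟩
        sumBelow d (λ j → size (λ v → M (v - j ⊗ x)))
          ≡⟨ sumBelow-cong d (λ j → size-coset (j ⊗ x)) ⟩
        sumBelow d (λ _ → size M)
          ≡⟨ sumBelow-const d (size M) ⟩
        d * size M
          ∎
        where open ≡-Reasoning

    prime-order : ∀ {u p} → Prime p → (p ⊗ u) ∈ᴮ M → M u ≡ false → OrderModulo u p
    prime-order {u} {p} p-prime pu∈M u∉M
      with order-exists {u} p {{prime⇒nonZero p-prime}} pu∈M
    ... | _ , u-ord with prime⇒irreducible p-prime (OrderModulo.minimal u-ord pu∈M)
    ...   | inj₂ refl = u-ord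
    ...   | inj₁ refl with () ← trans (sym u∉M) (subst (_∈ᴮ M) (×-homo-1 u) (OrderModulo.kills u-ord))

    order-of-multiple : ∀ {y r c p} → OrderModulo y r → r ≡ c * p → 0 < p → OrderModulo (c ⊗ y) p
    order-of-multiple {y} {r} {c} {p} y-ord r≡cp p>0 = record
      { positive = p>0
      ; kills    = subst (_∈ᴮ M) (trans (cong (_⊗ y) (trans r≡cp (*-comm c p))) (sym (×-assocˡ y p c))) kills
      ; minimal  = λ {j} jcy∈M → *-cancelˡ-∣ c {{c-nonZero}}
          (subst₂ _∣_ r≡cp (*-comm j c) (minimal (subst (_∈ᴮ M) (×-assocˡ y j c) jcy∈M)))
      }
      where
      open OrderModulo y-ord
      c-nonZero : NonZero c
      c-nonZero = m*n≢0⇒m≢0 c {{subst NonZero r≡cp (>-nonZero positive)}}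

    order-of-prime-divisor : ∀ {y r p} → OrderModulo y r → Prime p → p ∣ r → ∃ λ z → OrderModulo z p
    order-of-prime-divisor {y} {p = p} y-ord p-prime (divides c r≡cp) =
      c ⊗ y , order-of-multiple {c = c} y-ord r≡cp (>-nonZero⁻¹ p {{prime⇒nonZero p-prime}})

  full : A → Bool
  full _ = true

  module TwoGenerated {α β : A} (N : ℕ) .{{_ : NonZero N}}
                      (α-torsion : N ⊗ α ≡ 𝟘) (β-torsion : N ⊗ β ≡ 𝟘)
                      (generated : ∀ v → ∃₂ λ i j → v ≡ i ⊗ α ⊕ j ⊗ β) where

    -- Adjoining α and then β to L exhausts A,
    -- so [A : L] = d₂·d₁ with d₁ the order of α modulo L and d₂ that of β
    -- modulo L + ⟨α⟩; p divides one of them, and so the order of α or β.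
    cauchy : ∀ {L} (L-sub : IsSubgroupᴮ L) {p} → Prime p → p * size L ∣ size full →
             ∃ λ z → Modulo.OrderModulo L-sub z p
    cauchy {L} L-sub {p} p-prime p∣index = from-divisor (euclidsLemma d₂ d₁ p-prime p∣d₂d₁)
      where
      open Modulo L-sub
      torsion∈ : ∀ {S} → IsSubgroupᴮ S → ∀ {y} → N ⊗ y ≡ 𝟘 → (N ⊗ y) ∈ᴮ S
      torsion∈ {S} S-sub Ny≡𝟘 = subst (_∈ᴮ S) (sym Ny≡𝟘) (IsSubgroupᴮ.𝟘∈ S-sub)
      α-order : ∃ (OrderModulo α)
      α-order = order-exists N (torsion∈ L-sub α-torsion)
      d₁ : ℕ
      d₁ = proj₁ α-order
      module L₁ = Span (proj₂ α-order)
      module Mod₁ = Modulo L₁.span-subgroup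
      β-order : ∃ (Mod₁.OrderModulo β)
      β-order = Mod₁.order-exists N (torsion∈ L₁.span-subgroup β-torsion)
      d₂ : ℕ
      d₂ = proj₁ β-order
      module L₂ = Mod₁.Span (proj₂ β-order)
      everything∈L₂ : ∀ v → v ∈ᴮ L₂.span
      everything∈L₂ v with generated v
      ... | i , j , refl = IsSubgroupᴮ.⊕∈ L₂.span-subgroup
                             (L₂.M⊆span (IsSubgroupᴮ.⊗∈ L₁.span-subgroup i L₁.x∈span))
                             (IsSubgroupᴮ.⊗∈ L₂.span-subgroup j L₂.x∈span)
      size-full : size full ≡ (d₂ * d₁) * size L
      size-full = begin
        size full            ≡⟨ ∑-cong (λ v → cong ind (sym (everything∈L₂ v))) ⟩
        size L₂.span         ≡⟨ L₂.size-span ⟩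
        d₂ * size L₁.span    ≡⟨ cong (d₂ *_) L₁.size-span ⟩
        d₂ * (d₁ * size L)   ≡⟨ sym (*-assoc d₂ d₁ (size L)) ⟩
        (d₂ * d₁) * size L   ∎
        where open ≡-Reasoning
      p∣d₂d₁ : p ∣ d₂ * d₁
      p∣d₂d₁ = *-cancelʳ-∣ (size L) {{>-nonZero (size-≥1 {L} (IsSubgroupᴮ.𝟘∈ L-sub))}}
                 (subst (p * size L ∣_) size-full p∣index)
      β-order-mod-L : ∃ (OrderModulo β)
      β-order-mod-L = order-exists N (torsion∈ L-sub β-torsion)
      d₂∣order-of-β : d₂ ∣ proj₁ β-order-mod-L
      d₂∣order-of-β = Mod₁.OrderModulo.minimal (proj₂ β-order)
                        (L₁.M⊆span (OrderModulo.kills (proj₂ β-order-mod-L)))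
      from-divisor : p ∣ d₂ ⊎ p ∣ d₁ → ∃ λ z → OrderModulo z p
      from-divisor (inj₂ p∣d₁) = order-of-prime-divisor (proj₂ α-order) p-prime p∣d₁
      from-divisor (inj₁ p∣d₂) =
        order-of-prime-divisor (proj₂ β-order-mod-L) p-prime (∣-trans p∣d₂ d₂∣order-of-β)

    module Involution (σ : A → A) (σ-⊕ : ∀ x y → σ (x ⊕ y) ≡ σ x ⊕ σ y)
                      (σ-involutive : ∀ x → σ (σ x) ≡ x) where

      σ-𝟘 : σ 𝟘 ≡ 𝟘
      σ-𝟘 = identityʳ-unique (σ 𝟘) (σ 𝟘) (trans (sym (σ-⊕ 𝟘 𝟘)) (cong σ (identityʳ 𝟘)))

      σ-⊖ : ∀ x → σ (⊖ x) ≡ ⊖ σ x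
      σ-⊖ x = inverseʳ-unique (σ x) (σ (⊖ x)) (trans (sym (σ-⊕ x (⊖ x))) (trans (cong σ (inverseʳ x)) σ-𝟘))

      σ-⊗ : ∀ j x → σ (j ⊗ x) ≡ j ⊗ σ x
      σ-⊗ zero    x = σ-𝟘
      σ-⊗ (suc j) x = trans (σ-⊕ x (j ⊗ x)) (cong (σ x ⊕_) (σ-⊗ j x))

      Invariant : (A → Bool) → Set
      Invariant L = ∀ {v} → v ∈ᴮ L → σ v ∈ᴮ L

      σ-∼ : ∀ {L} (L-sub : IsSubgroupᴮ L) → Invariant L →
            ∀ {v w} → Modulo._∼_ L-sub v w → Modulo._∼_ L-sub (σ v) (σ w)
      σ-∼ {L} L-sub L-inv {v} {w} v∼w =
        subst (_∈ᴮ L) (trans (σ-⊕ v (⊖ w)) (cong (σ v ⊕_) (σ-⊖ w))) (L-inv v∼w)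

      record Eigenvector {L} (L-sub : IsSubgroupᴮ L) (d : ℕ) : Set where
        open Modulo L-sub
        field
          vector : A
          order  : OrderModulo vector d
          eigen  : σ vector ∼ vector ⊎ σ vector ∼ ⊖ vector

      -- Given an element z of prime order p modulo L, there is an eigenvector
      -- of order p: z itself when σz ≡ -z, and otherwise z + σz, which is
      -- fixed by σ.
      eigenvector : ∀ {L} (L-sub : IsSubgroupᴮ L) → Invariant L → ∀ {z p} → Prime p →
                    Modulo.OrderModulo L-sub z p → Eigenvector L-sub p
      eigenvector {L} L-sub L-inv {z} {p} p-prime z-ord with L (z ⊕ σ z) in z+σz∈L
      ... | true  = record { vector = z ; order = z-ord
                           ; eigen = inj₂ (⊕∈⇒∼⊖ (subst (_∈ᴮ L) (comm z (σ z)) z+σz∈L)) }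
        where open Modulo L-sub
      ... | false = record { vector = z ⊕ σ z ; order = prime-order p-prime p[z+σz]∈L z+σz∈L
                           ; eigen = inj₁ (subst (_∼ (z ⊕ σ z)) σ-fixed ∼-refl) }
        where
        open Modulo L-sub
        σ-fixed : z ⊕ σ z ≡ σ (z ⊕ σ z)
        σ-fixed = trans (comm z (σ z)) (sym (trans (σ-⊕ z (σ z)) (cong (σ z ⊕_) (σ-involutive z))))
        p[z+σz]∈L : (p ⊗ (z ⊕ σ z)) ∈ᴮ L
        p[z+σz]∈L = subst (_∈ᴮ L) (sym (trans (×-distrib-+ z (σ z) p) (cong (p ⊗ z ⊕_) (sym (σ-⊗ p z)))))
                      (IsSubgroupᴮ.⊕∈ L-sub (OrderModulo.kills z-ord) (L-inv (OrderModulo.kills z-ord)))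

      record Extension (L : A → Bool) (q : ℕ) : Set where
        field
          L′           : A → Bool
          L′-subgroup  : IsSubgroupᴮ L′
          L′-invariant : Invariant L′
          L⊆L′         : ∀ {v} → v ∈ᴮ L → v ∈ᴮ L′
          size-L′      : size L′ ≡ q * size L

      -- Adjoining to L an eigenvector x of order d gives a σ-invariant
      -- subgroup L + ⟨x⟩, since σ maps x into it.
      adjoin-eigenvector : ∀ {L} (L-sub : IsSubgroupᴮ L) → Invariant L → ∀ {d} →
                           Eigenvector L-sub d → Extension L d
      adjoin-eigenvector {L} L-sub L-inv eigenvector = record
        { L′ = span ; L′-subgroup = span-subgroup ; L′-invariant = span-invariant
        ; L⊆L′ = M⊆span ; size-L′ = size-span }
        where
        open Modulo L-sub
        open Eigenvector eigenvector renaming (vector to x)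
        open Span order
        σx∈span : σ x ∈ᴮ span
        σx∈span = from-eigen eigen
          where
          from-eigen : σ x ∼ x ⊎ σ x ∼ ⊖ x → σ x ∈ᴮ span
          from-eigen (inj₁ σx∼x)  = span-saturated σx∼x x∈span
          from-eigen (inj₂ σx∼⊖x) = span-saturated σx∼⊖x (IsSubgroupᴮ.⊖∈ span-subgroup x∈span)
        span-invariant : Invariant span
        span-invariant v∈span with span-elim v∈span
        ... | j , _ , v∼jx = span-saturated (subst (_ ∼_) (σ-⊗ j x) (σ-∼ L-sub L-inv v∼jx))
                                            (IsSubgroupᴮ.⊗∈ span-subgroup j σx∈span)

      extend-prime : ∀ {L} → IsSubgroupᴮ L → Invariant L → ∀ {p} → Prime p →
                     p * size L ∣ size full → Extension L p
      extend-prime L-sub L-inv p-prime p∣index =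
        adjoin-eigenvector L-sub L-inv (eigenvector L-sub L-inv p-prime (proj₂ (cauchy L-sub p-prime p∣index)))

      extension-refl : ∀ {L} → IsSubgroupᴮ L → Invariant L → Extension L 1
      extension-refl {L} L-sub L-inv = record
        { L′ = L ; L′-subgroup = L-sub ; L′-invariant = L-inv ; L⊆L′ = λ v∈L → v∈L
        ; size-L′ = sym (+-identityʳ (size L)) }

      extension-trans : ∀ {L p q} (E : Extension L p) → Extension (Extension.L′ E) q → Extension L (p * q)
      extension-trans {L} {p} {q} E E′ = record
        { L′ = Extension.L′ E′ ; L′-subgroup = Extension.L′-subgroup E′
        ; L′-invariant = Extension.L′-invariant E′
        ; L⊆L′ = λ v∈L → Extension.L⊆L′ E′ (Extension.L⊆L′ E v∈L)
        ; size-L′ = trans (Extension.size-L′ E′)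
                          (trans (cong (q *_) (Extension.size-L′ E)) (q*[p*s]≡[p*q]*s p q (size L))) }

      extend-primes : ∀ {L} → IsSubgroupᴮ L → Invariant L → ∀ {ps} → All Prime ps →
                      product ps * size L ∣ size full → Extension L (product ps)
      extend-primes L-sub L-inv [] _ = extension-refl L-sub L-inv
      extend-primes {L} L-sub L-inv {p ∷ ps} (p-prime ∷ ps-prime) index∣ =
        extension-trans E (extend-primes (Extension.L′-subgroup E) (Extension.L′-invariant E) ps-prime index∣′)
        where
        E : Extension L p
        E = extend-prime L-sub L-inv p-prime (∣-trans (divides (product ps) (sym (q*[p*s]≡[p*q]*s p _ _))) index∣)
        index∣′ : product ps * size (Extension.L′ E) ∣ size full
        index∣′ = subst (_∣ size full)
                    (trans (sym (q*[p*s]≡[p*q]*s p _ _)) (cong (product ps *_) (sym (Extension.size-L′ E)))) index∣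

      extend : ∀ {L} → IsSubgroupᴮ L → Invariant L → ∀ q .{{_ : NonZero q}} →
               q * size L ∣ size full → Extension L q
      extend L-sub L-inv q index∣ = subst (Extension _) (sym q≡∏) 
        (extend-primes L-sub L-inv factorsPrime (subst (λ r → r * _ ∣ size full) q≡∏ index∣))
        where open PrimeFactorisation (factorise q) renaming (isFactorisation to q≡∏)

isAbelianGroup-from : ∀ {X : Set} {_∙_ : Op₂ X} {ε : X} {_⁻¹ : Op₁ X} →
  (∀ x y z → (x ∙ y) ∙ z ≡ x ∙ (y ∙ z)) → (∀ x y → x ∙ y ≡ y ∙ x) →
  (∀ x → ε ∙ x ≡ x) → (∀ x → (x ⁻¹) ∙ x ≡ ε) → IsAbelianGroup _≡_ _∙_ ε _⁻¹
isAbelianGroup-from {_∙_ = _∙_} {ε} {_⁻¹} assoc comm idˡ invˡ = record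
  { isGroup = record
    { isMonoid = record
      { isSemigroup = record { isMagma = record { isEquivalence = isEquivalence ; ∙-cong = cong₂ _∙_ } ; assoc = assoc }
      ; identity = idˡ , λ x → trans (comm x ε) (idˡ x) }
    ; inverse = invˡ , λ x → trans (comm x (x ⁻¹)) (invˡ x)
    ; ⁻¹-cong = cong _⁻¹ }
  ; comm = comm }

module ℤMod (n : ℕ) .{{_ : NonZero n}} where

  Z : Set
  Z = Fin n

  toℕ-addZ : ∀ a b → toℕ (addZ n a b) ≡ (toℕ a + toℕ b) % n
  toℕ-addZ a b = toℕ-fromℕ< _

  toℕ-negZ : ∀ a → toℕ (negZ n a) ≡ (n ∸ toℕ a) % n
  toℕ-negZ a = toℕ-fromℕ< _

  toℕ-zeroZ : toℕ (zeroZ n) ≡ 0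
  toℕ-zeroZ = trans (toℕ-fromℕ< _) (m*n%n≡0 0 n)

  %-absorbˡ : ∀ x y → (x % n + y) % n ≡ (x + y) % n
  %-absorbˡ x y = begin
    (x % n + y) % n           ≡⟨ %-distribˡ-+ (x % n) y n ⟩
    (x % n % n + y % n) % n   ≡⟨ cong (λ u → (u + y % n) % n) (m%n%n≡m%n x n) ⟩
    (x % n + y % n) % n       ≡⟨ sym (%-distribˡ-+ x y n) ⟩
    (x + y) % n               ∎
    where open ≡-Reasoning

  %-absorbʳ : ∀ x y → (x + y % n) % n ≡ (x + y) % n
  %-absorbʳ x y = trans (cong (_% n) (+-comm x (y % n))) (trans (%-absorbˡ y x) (cong (_% n) (+-comm y x)))

  addZ-assoc : ∀ a b c → addZ n (addZ n a b) c ≡ addZ n a (addZ n b c)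
  addZ-assoc a b c = toℕ-injective (begin
    toℕ (addZ n (addZ n a b) c)         ≡⟨ toℕ-addZ _ c ⟩
    (toℕ (addZ n a b) + toℕ c) % n      ≡⟨ cong (λ u → (u + toℕ c) % n) (toℕ-addZ a b) ⟩
    ((toℕ a + toℕ b) % n + toℕ c) % n   ≡⟨ %-absorbˡ (toℕ a + toℕ b) (toℕ c) ⟩
    (toℕ a + toℕ b + toℕ c) % n         ≡⟨ cong (_% n) (+-assoc (toℕ a) (toℕ b) (toℕ c)) ⟩
    (toℕ a + (toℕ b + toℕ c)) % n       ≡⟨ sym (%-absorbʳ (toℕ a) (toℕ b + toℕ c)) ⟩
    (toℕ a + (toℕ b + toℕ c) % n) % n   ≡⟨ cong (λ u → (toℕ a + u) % n) (sym (toℕ-addZ b c)) ⟩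
    (toℕ a + toℕ (addZ n b c)) % n      ≡⟨ sym (toℕ-addZ a _) ⟩
    toℕ (addZ n a (addZ n b c))         ∎)
    where open ≡-Reasoning

  addZ-comm : ∀ a b → addZ n a b ≡ addZ n b a
  addZ-comm a b = toℕ-injective (trans (toℕ-addZ a b) (trans (cong (_% n) (+-comm (toℕ a) (toℕ b))) (sym (toℕ-addZ b a))))

  addZ-identityˡ : ∀ a → addZ n (zeroZ n) a ≡ a
  addZ-identityˡ a = toℕ-injective (trans (toℕ-addZ _ a)
    (trans (cong (λ u → (u + toℕ a) % n) toℕ-zeroZ) (m<n⇒m%n≡m (toℕ<n a))))

  addZ-inverseˡ : ∀ a → addZ n (negZ n a) a ≡ zeroZ n
  addZ-inverseˡ a = toℕ-injective (begin
    toℕ (addZ n (negZ n a) a)          ≡⟨ toℕ-addZ _ a ⟩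
    (toℕ (negZ n a) + toℕ a) % n       ≡⟨ cong (λ u → (u + toℕ a) % n) (toℕ-negZ a) ⟩
    ((n ∸ toℕ a) % n + toℕ a) % n      ≡⟨ %-absorbˡ (n ∸ toℕ a) (toℕ a) ⟩
    (n ∸ toℕ a + toℕ a) % n            ≡⟨ cong (_% n) (m∸n+n≡m (<⇒≤ (toℕ<n a))) ⟩
    n % n                              ≡⟨ trans (n%n≡0 n) (sym toℕ-zeroZ) ⟩
    toℕ (zeroZ n)                      ∎)
    where open ≡-Reasoning

  addZ-identityʳ : ∀ a → addZ n a (zeroZ n) ≡ a
  addZ-identityʳ a = trans (addZ-comm a _) (addZ-identityˡ a)

  mulZ : ℕ → Z → Z
  mulZ zero    a = zeroZ n
  mulZ (suc j) a = addZ n a (mulZ j a)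

  toℕ-mulZ : ∀ j a → toℕ (mulZ j a) ≡ (j * toℕ a) % n
  toℕ-mulZ zero    a = trans toℕ-zeroZ (sym (m*n%n≡0 0 n))
  toℕ-mulZ (suc j) a = trans (toℕ-addZ a (mulZ j a))
    (trans (cong (λ u → (toℕ a + u) % n) (toℕ-mulZ j a)) (%-absorbʳ (toℕ a) (j * toℕ a)))

  mulZ-n : ∀ a → mulZ n a ≡ zeroZ n
  mulZ-n a = toℕ-injective (trans (toℕ-mulZ n a)
    (trans (cong (_% n) (*-comm n (toℕ a))) (trans (m*n%n≡0 (toℕ a) n) (sym toℕ-zeroZ))))

  oneZ : Z
  oneZ = 1 mod n

  mulZ-one : ∀ a → mulZ (toℕ a) oneZ ≡ a
  mulZ-one a = toℕ-injective (begin
    toℕ (mulZ (toℕ a) oneZ)           ≡⟨ toℕ-mulZ (toℕ a) oneZ ⟩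
    (toℕ a * toℕ oneZ) % n            ≡⟨ cong (λ u → (toℕ a * u) % n) (toℕ-fromℕ< _) ⟩
    (toℕ a * (1 % n)) % n             ≡⟨ %-distribˡ-* (toℕ a) (1 % n) n ⟩
    (toℕ a % n * (1 % n % n)) % n     ≡⟨ cong (λ u → (toℕ a % n * u) % n) (m%n%n≡m%n 1 n) ⟩
    (toℕ a % n * (1 % n)) % n         ≡⟨ sym (%-distribˡ-* (toℕ a) 1 n) ⟩
    (toℕ a * 1) % n                   ≡⟨ cong (_% n) (*-identityʳ (toℕ a)) ⟩
    toℕ a % n                         ≡⟨ m<n⇒m%n≡m (toℕ<n a) ⟩
    toℕ a                             ∎)
    where open ≡-Reasoning

  mulZ-zero : ∀ j → mulZ j (zeroZ n) ≡ zeroZ n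
  mulZ-zero zero    = refl
  mulZ-zero (suc j) = trans (cong (addZ n (zeroZ n)) (mulZ-zero j)) (addZ-identityˡ (zeroZ n))

sum-point : ∀ {m} (f : Fin m → ℕ) i → f i ≤ sum f
sum-point f Fin.zero    = m≤m+n _ _
sum-point f (Fin.suc i) = ≤-trans (sum-point (λ j → f (Fin.suc j)) i) (m≤n+m _ _)

sum-support : ∀ {m} (f : Fin m → ℕ) → 0 < sum f → ∃ λ i → 0 < f i
sum-support {suc m} f sum>0 with f Fin.zero in f₀
... | suc _ = Fin.zero , subst (0 <_) (sym f₀) (s≤s z≤n)
... | zero with sum-support (λ i → f (Fin.suc i)) sum>0
...   | i , fi>0 = Fin.suc i , fi>0

module Plane (n : ℕ) .{{_ : NonZero n}} where
  open ℤMod n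

  A : Set
  A = Z × Z

  infixl 6 _⊕_
  _⊕_ : A → A → A
  x ⊕ y = addZ n (proj₁ x) (proj₁ y) , addZ n (proj₂ x) (proj₂ y)

  ⊖_ : A → A
  ⊖ x = negZ n (proj₁ x) , negZ n (proj₂ x)

  𝟘 : A
  𝟘 = zeroZ n , zeroZ n

  isAbelianGroupᴬ : IsAbelianGroup _≡_ _⊕_ 𝟘 ⊖_
  isAbelianGroupᴬ = isAbelianGroup-from
    (λ (a₁ , b₁) (a₂ , b₂) (a₃ , b₃) → cong₂ _,_ (addZ-assoc a₁ a₂ a₃) (addZ-assoc b₁ b₂ b₃))
    (λ (a₁ , b₁) (a₂ , b₂) → cong₂ _,_ (addZ-comm a₁ a₂) (addZ-comm b₁ b₂))
    (λ (a , b) → cong₂ _,_ (addZ-identityˡ a) (addZ-identityˡ b))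
    (λ (a , b) → cong₂ _,_ (addZ-inverseˡ a) (addZ-inverseˡ b))

  translation : Z → Permutation n n
  translation c = permutation (λ a → addZ n a c) (λ a → addZ n a (negZ n c)) (cancel c) (cancel′ c)
    where
    cancel : ∀ c a → addZ n (addZ n a (negZ n c)) c ≡ a
    cancel c a = trans (addZ-assoc a _ c) (trans (cong (addZ n a) (addZ-inverseˡ c))
                   (trans (addZ-comm a _) (addZ-identityˡ a)))
    cancel′ : ∀ c a → addZ n (addZ n a c) (negZ n c) ≡ a
    cancel′ c a = trans (addZ-assoc a c _) (trans (cong (addZ n a) (trans (addZ-comm c _) (addZ-inverseˡ c)))
                    (trans (addZ-comm a _) (addZ-identityˡ a)))

  sum-translate : ∀ (f : Z → ℕ) c → sum (λ a → f (addZ n a c)) ≡ sum f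
  sum-translate f c = sym (sum-permute f (translation c))

  -- Summation over A as a double sum over ℤ/n; it is translation-invariant
  -- because translations permute ℤ/n.
  ∑ᴬ : (A → ℕ) → ℕ
  ∑ᴬ f = sum (λ a → sum (λ b → f (a , b)))

  countingᴬ : Counting A _⊕_
  countingᴬ = record
    { ∑         = ∑ᴬ
    ; ∑-cong    = λ f≗g → sum-cong-≗ (λ a → sum-cong-≗ (λ b → f≗g (a , b)))
    ; ∑-+       = λ f g → trans (sum-cong-≗ (λ a → ∑-distrib-+ (λ b → f (a , b)) (λ b → g (a , b))))
                                (∑-distrib-+ (λ a → sum (λ b → f (a , b))) (λ a → sum (λ b → g (a , b))))
    ; ∑-shift   = λ f c → trans (sum-cong-≗ (λ a → sum-translate (λ b → f (addZ n a (proj₁ c) , b)) (proj₂ c)))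
                                (sum-translate (λ a → sum (λ b → f (a , b))) (proj₁ c))
    ; ∑-point   = λ f v → ≤-trans (sum-point (λ b → f (proj₁ v , b)) (proj₂ v))
                                  (sum-point (λ a → sum (λ b → f (a , b))) (proj₁ v))
    ; ∑-support = support
    }
    where
    support : ∀ f → 0 < ∑ᴬ f → ∃ λ v → 0 < f v
    support f ∑>0 with sum-support _ ∑>0
    ... | a , row>0 with sum-support _ row>0
    ...   | b , fab>0 = (a , b) , fab>0

  𝔸 : FiniteAbelianGroup
  𝔸 = record
    { Carrier = A ; _⊕_ = _⊕_ ; 𝟘 = 𝟘 ; ⊖_ = ⊖_ ; isAbelianGroup = isAbelianGroupᴬ ; counting = countingᴬ }

  open FiniteAbelianGroupTheory 𝔸 public using (_⊗_; size; size-≥1; full; IsSubgroupᴮ; module Modulo; module TwoGenerated)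

  ⊗-componentwise : ∀ j v → j ⊗ v ≡ (mulZ j (proj₁ v) , mulZ j (proj₂ v))
  ⊗-componentwise zero    v = refl
  ⊗-componentwise (suc j) v = cong (v ⊕_) (⊗-componentwise j v)

  exponent : ∀ v → n ⊗ v ≡ 𝟘
  exponent v = trans (⊗-componentwise n v) (cong₂ _,_ (mulZ-n (proj₁ v)) (mulZ-n (proj₂ v)))

  α β : A
  α = oneZ , zeroZ n
  β = zeroZ n , oneZ

  generated : ∀ v → ∃₂ λ i j → v ≡ i ⊗ α ⊕ j ⊗ β
  generated (a , b) = toℕ a , toℕ b , sym (begin
    toℕ a ⊗ α ⊕ toℕ b ⊗ β
      ≡⟨ cong₂ _⊕_ (⊗-componentwise (toℕ a) α) (⊗-componentwise (toℕ b) β) ⟩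
    (addZ n (mulZ (toℕ a) oneZ) (mulZ (toℕ b) (zeroZ n)) , addZ n (mulZ (toℕ a) (zeroZ n)) (mulZ (toℕ b) oneZ))
      ≡⟨ cong₂ _,_ (cong₂ (addZ n) (mulZ-one a) (mulZ-zero (toℕ b)))
                   (cong₂ (addZ n) (mulZ-zero (toℕ a)) (mulZ-one b)) ⟩
    (addZ n a (zeroZ n) , addZ n (zeroZ n) b)
      ≡⟨ cong₂ _,_ (addZ-identityʳ a) (addZ-identityˡ b) ⟩
    (a , b) ∎)
    where open ≡-Reasoning

  swap : A → A
  swap (a , b) = b , a

  open TwoGenerated n (exponent α) (exponent β) generated public using (module Involution)
  open Involution swap (λ _ _ → refl) (λ _ → refl) public using (Invariant; Extension; extend)

length-filter : ∀ {X : Set} (S : X → Bool) xs →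
                length (filter (λ x → T? (S x)) xs) ≡ listSum (map (λ x → ind (S x)) xs)
length-filter S []       = refl
length-filter S (x ∷ xs) with S x
... | true  = cong suc (length-filter S xs)
... | false = length-filter S xs

listSum-concatMap : ∀ {X Y : Set} (h : Y → ℕ) (f : X → List Y) xs →
                    listSum (map h (concatMap f xs)) ≡ listSum (map (λ x → listSum (map h (f x))) xs)
listSum-concatMap h f []       = refl
listSum-concatMap h f (x ∷ xs) = begin
  listSum (map h (f x ++ concatMap f xs))          ≡⟨ cong listSum (map-++ h (f x) (concatMap f xs)) ⟩
  listSum (map h (f x) ++ map h (concatMap f xs))  ≡⟨ listSum-++ (map h (f x)) _ ⟩
  listSum (map h (f x)) + listSum (map h (concatMap f xs))   ≡⟨ cong (listSum (map h (f x)) +_) (listSum-concatMap h f xs) ⟩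
  listSum (map h (f x)) + listSum (map (λ x → listSum (map h (f x))) xs) ∎
  where open ≡-Reasoning

listSum-allFin : ∀ {m} (g : Fin m → ℕ) → listSum (map g (allFin m)) ≡ sum g
listSum-allFin {m} g = trans (cong listSum (map-tabulate {n = m} (λ i → i) g)) (listSum-tabulate g)
  where
  listSum-tabulate : ∀ {k} (h : Fin k → ℕ) → listSum (tabulate h) ≡ sum h
  listSum-tabulate {zero}  h = refl
  listSum-tabulate {suc k} h = cong (h Fin.zero +_) (listSum-tabulate (λ i → h (Fin.suc i)))

module Semidirect (n : ℕ) .{{_ : NonZero n}} where
  open ℤMod n
  open Plane n

  card-layers : (K : Subset n) →
    card K ≡ ∑ᴬ (λ v → ind (K (proj₁ v , proj₂ v , false)) + ind (K (proj₁ v , proj₂ v , true)))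
  card-layers K = begin
    card K                                                       ≡⟨ length-filter K (elements n) ⟩
    listSum (map h (elements n))                                 ≡⟨ listSum-concatMap h row (allFin n) ⟩
    listSum (map (λ a → listSum (map h (row a))) (allFin n))     ≡⟨ cong listSum (map-cong row-sum (allFin n)) ⟩
    listSum (map (λ a → sum (λ b → layers (a , b))) (allFin n))  ≡⟨ listSum-allFin {n} _ ⟩
    ∑ᴬ layers                                                    ∎
    where
    open ≡-Reasoning
    h : G n → ℕ
    h g = ind (K g)
    layers : A → ℕ
    layers v = ind (K (proj₁ v , proj₂ v , false)) + ind (K (proj₁ v , proj₂ v , true))
    row : Z → List (G n)
    row a = concatMap (λ b → map (λ t → (a , b , t)) (false ∷ true ∷ [])) (allFin n)
    row-sum : ∀ a → listSum (map h (row a)) ≡ sum (λ b → layers (a , b))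
    row-sum a = trans (listSum-concatMap h _ (allFin n))
      (trans (listSum-allFin (λ b → ind (K (a , b , false)) + (ind (K (a , b , true)) + 0)))
             (sum-cong-≗ (λ b → cong (ind (K (a , b , false)) +_) (+-identityʳ _))))

  two-layers : ∀ (L : A → Bool) → ∑ᴬ (λ v → ind (L v) + ind (L v)) ≡ 2 * size L
  two-layers L = trans (Counting.∑-+ countingᴬ _ _) (cong (size L +_) (sym (+-identityʳ (size L))))

  translations : Subset n → A → Bool
  translations K v = K (proj₁ v , proj₂ v , false)

  module SubgroupWithτ {K : Subset n} (K-sub : IsSubgroup K) (τ∈K : τ ∈ K) where
    open IsSubgroup K-sub

    ·τ-false : ∀ a b → (a , b , false) · τ ≡ (a , b , true)
    ·τ-false a b = cong₂ (λ u w → (u , w , true)) (addZ-identityʳ a) (addZ-identityʳ b)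

    ·τ-true : ∀ a b → (a , b , true) · τ ≡ (a , b , false)
    ·τ-true a b = cong₂ (λ u w → (u , w , false)) (addZ-identityʳ a) (addZ-identityʳ b)

    layers-agree : ∀ a b → K (a , b , true) ≡ K (a , b , false)
    layers-agree a b = Bool-ext
      (λ p → subst (_∈ K) (·τ-true a b) (closed· _ _ p τ∈K))
      (λ p → subst (_∈ K) (·τ-false a b) (closed· _ _ p τ∈K))

    translations-subgroup : IsSubgroupᴮ (translations K)
    translations-subgroup = record
      { 𝟘∈ = has-e ; ⊕∈ = λ p q → closed· _ _ p q ; ⊖∈ = λ p → closed⁻ _ p }

    -- Conjugation by τ is the swap: τ (v, 0) τ = (swap v, 0).
    translations-invariant : Invariant (translations K)
    translations-invariant {a , b} p = subst (_∈ K)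
      (cong₂ (λ u w → (u , w , false)) (trans (addZ-identityʳ _) (addZ-identityˡ b))
                                        (trans (addZ-identityʳ _) (addZ-identityˡ a)))
      (closed· _ _ (closed· _ _ τ∈K p) τ∈K)

    -- The two layers of K agree, so |K| = 2|L|.
    card-K : card K ≡ 2 * size (translations K)
    card-K = trans (card-layers K)
      (trans (Counting.∑-cong countingᴬ (λ v → cong (ind (translations K v) +_)
                                                    (cong ind (layers-agree (proj₁ v) (proj₂ v)))))
             (two-layers (translations K)))

  _⋊τ : (A → Bool) → Subset n
  (L ⋊τ) g = L (proj₁ g , proj₁ (proj₂ g))

  module InvariantSubgroup {L : A → Bool} (L-sub : IsSubgroupᴮ L) (L-inv : Invariant L) where
    open IsSubgroupᴮ L-sub

    ⋊τ-subgroup : IsSubgroup (L ⋊τ)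
    ⋊τ-subgroup = record { has-e = 𝟘∈ ; closed· = closed-· ; closed⁻ = closed-⁻ }
      where
      closed-· : ∀ g h → g ∈ (L ⋊τ) → h ∈ (L ⋊τ) → (g · h) ∈ (L ⋊τ)
      closed-· (a , b , false) (c , d , t) p q = ⊕∈ p q
      closed-· (a , b , true)  (c , d , t) p q = ⊕∈ p (L-inv q)
      closed-⁻ : ∀ g → g ∈ (L ⋊τ) → inv g ∈ (L ⋊τ)
      closed-⁻ (a , b , false) p = ⊖∈ p
      closed-⁻ (a , b , true)  p = ⊖∈ (L-inv p)

    card-⋊τ : card (L ⋊τ) ≡ 2 * size L
    card-⋊τ = trans (card-layers (L ⋊τ)) (two-layers L)

  orderG≡ : orderG n ≡ 2 * size full
  orderG≡ = trans (card-layers (λ _ → true)) (two-layers full)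

  -- Necessity: an overgroup K of H has positive order, divisible by |H| and
  -- dividing |G|, by Lagrange's theorem for the translation parts.
  overgroup-order : ∀ {H K} → IsSubgroup H → τ ∈ H → IsSubgroup K → H ⊆ K →
                    0 < card K × card H ∣ card K × card K ∣ orderG n
  overgroup-order {H} {K} H-sub τ∈H K-sub H⊆K =
      subst (0 <_) (sym K.card-K) (≤-trans (s≤s z≤n) (*-monoʳ-≤ 2 (size-≥1 {translations K} (IsSubgroup.has-e K-sub))))
    , subst₂ _∣_ (sym H.card-K) (sym K.card-K) (*-monoʳ-∣ 2 (Modulo.lagrange H.translations-subgroup K-saturated))
    , subst₂ _∣_ (sym K.card-K) (sym orderG≡) (*-monoʳ-∣ 2 (Modulo.lagrange K.translations-subgroup (λ _ _ → refl)))
    where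
    module H = SubgroupWithτ H-sub τ∈H
    module K = SubgroupWithτ K-sub (H⊆K τ τ∈H)
    K-saturated : Modulo.Saturated H.translations-subgroup (translations K)
    K-saturated p q = IsSubgroup.closed· K-sub _ _ p (H⊆K _ q)

  -- Sufficiency: for |H| ∣ m ∣ |G|, extend the translation part of H by the
  -- index c = m / |H| to a swap-invariant L′, and take K = L′ ⋊ ⟨τ⟩.
  overgroup-of-order : ∀ {H} → IsSubgroup H → τ ∈ H → ∀ {m} → 0 < m → card H ∣ m → m ∣ orderG n →
                       Σ (Subset n) λ K → IsSubgroup K × H ⊆ K × card K ≡ m
  overgroup-of-order {H} H-sub τ∈H {m} m>0 (divides c m≡c|H|) m∣G =
    Extension.L′ E ⋊τ , L′.⋊τ-subgroup , H⊆K ,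
    trans L′.card-⋊τ (trans (cong (2 *_) (Extension.size-L′ E)) (sym m≡2cs))
    where
    module H = SubgroupWithτ H-sub τ∈H
    s : ℕ
    s = size (translations H)
    m≡2cs : m ≡ 2 * (c * s)
    m≡2cs = trans m≡c|H| (trans (cong (c *_) H.card-K) (trans (q*[p*s]≡[p*q]*s 2 c s) (*-assoc 2 c s)))
    instance
      c-nonZero : NonZero c
      c-nonZero = m*n≢0⇒m≢0 c {{subst NonZero m≡c|H| (>-nonZero m>0)}}
    E : Extension (translations H) c
    E = extend H.translations-subgroup H.translations-invariant c
          (*-cancelˡ-∣ 2 (subst₂ _∣_ m≡2cs orderG≡ m∣G))
    module L′ = InvariantSubgroup (Extension.L′-subgroup E) (Extension.L′-invariant E)
    H⊆K : H ⊆ (Extension.L′ E ⋊τ)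
    H⊆K (a , b , false) p = Extension.L⊆L′ E p
    H⊆K (a , b , true)  p = Extension.L⊆L′ E (trans (sym (H.layers-agree a b)) p)

lemma3p7 : (n : ℕ) .{{_ : NonZero n}} (H : Subset n) → IsSubgroup H → τ ∈ H →
    (m : ℕ) → ((Σ (Subset n) λ K → IsSubgroup K × H ⊆ K × card K ≡ m) → (0 < m × card H ∣ m × m ∣ orderG n))
            × ((0 < m × card H ∣ m × m ∣ orderG n) → Σ (Subset n) λ K → IsSubgroup K × H ⊆ K × card K ≡ m)
lemma3p7 n H H-sub τ∈H m = necessary , sufficient
  where
  open Semidirect n
  necessary : (Σ (Subset n) λ K → IsSubgroup K × H ⊆ K × card K ≡ m) → 0 < m × card H ∣ m × m ∣ orderG n
  necessary (K , K-sub , H⊆K , refl) = overgroup-order H-sub τ∈H K-sub H⊆K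
  sufficient : 0 < m × card H ∣ m × m ∣ orderG n → Σ (Subset n) λ K → IsSubgroup K × H ⊆ K × card K ≡ m
  sufficient (m>0 , H∣m , m∣G) = overgroup-of-order H-sub τ∈H m>0 H∣m m∣G
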